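{- Let $a,q\in\mathbb{Z}$ with $q>0$ and $\gcd(a,q)=1$. Then \[ S(a/q)=\#\Big\{(c,d)\in\mathbb{Z}^2\ :\ d>0,\ 0<\frac aq-\frac cd<\frac1{d^2}\Big\}. \]
   Context: $S(a/q):=\#\{(m,n)\in\mathbb{Z}^2:\ m>0,\ n>0,\ mn<q,\ am\equiv n \pmod q\}$. Note the pairs $(c,d)$ on the right-hand side are not required to be coprime. -}

module Defs where

open import Data.Nat using (suc)
open import Data.Integer using (ℤ; +_; -[1+_]; _*_; _-_; _<_; 0ℤ)
open import Data.Integer.Divisibility using (_∣_)
open import Data.Rational using (ℚ; _/_; 0ℚ)
open import Data.Product using (Σ; _×_; _,_)
import Data.Rational as Q

_≡_[mod_] : ℤ → ℤ → ℤ → Set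
x ≡ y [mod q ] = q ∣ (x - y)

-- The rational number n/d for an integer denominator d.
-- Only used with d > 0; for d ≤ 0 it is junk (0).
frac : ℤ → ℤ → ℚ
frac n (+ suc k) = n / suc k
frac n (+ 0) = 0ℚ
frac n -[1+ k ] = 0ℚ

-- The set counted by S(a/q):
-- {(m,n) ∈ ℤ² : m > 0, n > 0, m n < q, a m ≡ n (mod q)}.
SSet : ℤ → ℤ → Set
SSet a q = Σ (ℤ × ℤ) λ { (m , n) →
  (0ℤ < m) × (0ℤ < n) × (m * n < q) × (_≡_[mod_] (a * m) n q) }

ApproxSet : ℤ → ℤ → Set
ApproxSet a q = Σ (ℤ × ℤ) λ { (c , d) →
  (0ℤ < d) × (0ℚ Q.< frac a q Q.- frac c d) × (frac a q Q.- frac c d Q.< frac (+ 1) (d * d)) }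

-- Writing n := a d − c q, the conditions 0 < a/q − c/d < 1/d² clear denominators to n > 0 and
-- d n < q, while n ≡ a d (mod q) with c recovered as (a d − n)/q. So (c , d) ↦ (d , a d − c q)
-- is a bijection onto the pairs counted by S(a/q). That
-- set is finite since m n < q with m , n > 0 confines both coordinates to (0 , q).
module Submission where

open import Defs
open import Data.Nat using (ℕ; zero; suc; s<s⁻¹; >-nonZero)
import Data.Nat as ℕ
import Data.Nat.Properties as ℕ
import Data.Nat.Divisibility as ℕ
open import Data.Integer using (ℤ; +_; -[1+_]; +<+; _+_; _*_; _-_; -_; _<_; ∣_∣; 0ℤ; NonZero)
open import Data.Integer.GCD using (gcd)
import Data.Integer.Properties as ℤ
import Data.Integer.Divisibility.Signed as ℤ
open import Data.Integer.Tactic.RingSolver using (solve-∀)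
open import Data.Rational using (ℚ; 0ℚ; toℚᵘ)
import Data.Rational as ℚ
import Data.Rational.Properties as ℚ
open import Data.Rational.Unnormalised using (ℚᵘ; mkℚᵘ; ↥_; ↧_; *<*)
import Data.Rational.Unnormalised as ℚᵘ
import Data.Rational.Unnormalised.Properties as ℚᵘ
open import Data.Fin using (Fin)
open import Data.Fin.Properties using (0↔⊥; 1↔⊤; +↔⊎)
open import Data.Product using (Σ; ∃; _×_; _,_; proj₁; proj₂)
open import Data.Product.Properties using (Σ-≡,≡→≡)
open import Data.Sum using (_⊎_; inj₁; inj₂)
open import Data.Sum.Function.Propositional using (_⊎-↔_)
open import Data.Empty using (⊥-elim)
open import Function.Base using (_∘_)
open import Function.Bundles using (_↔_; _⇔_; mk⇔; mk↔ₛ′; Equivalence)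
open import Function.Properties.Inverse using (↔-trans; ↔-sym)
import Function.Properties.Equivalence as ⇔
open import Relation.Nullary using (Dec; yes; no; Irrelevant)
open import Relation.Nullary.Decidable using (True-↔; _×-dec_)
open import Relation.Binary.PropositionalEquality
  using (_≡_; refl; sym; trans; cong; subst; module ≡-Reasoning)

private
  variable
    A B : Set

Finite : Set → Set
Finite A = Σ ℕ λ k → Fin k ↔ A

finite-↔ : A ↔ B → Finite A → Finite B
finite-↔ A↔B (k , Fin↔A) = k , ↔-trans Fin↔A A↔B

finite-Dec : Dec A → Irrelevant A → Finite A
finite-Dec a?@(yes _) irr = 1 , ↔-trans 1↔⊤ (True-↔ a? irr)
finite-Dec a?@(no _)  irr = 0 , ↔-trans 0↔⊥ (True-↔ a? irr)

finite-⊎ : Finite A → Finite B → Finite (A ⊎ B)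
finite-⊎ (k , Fin↔A) (l , Fin↔B) = k ℕ.+ l , ↔-trans +↔⊎ (Fin↔A ⊎-↔ Fin↔B)

Σℕ↔⊎ : (P : ℕ → Set) → (P 0 ⊎ Σ ℕ (P ∘ suc)) ↔ Σ ℕ P
Σℕ↔⊎ P = mk↔ₛ′ to from to∘from from∘to
  where
  to : P 0 ⊎ Σ ℕ (P ∘ suc) → Σ ℕ P
  to (inj₁ p)       = 0 , p
  to (inj₂ (n , p)) = suc n , p
  from : Σ ℕ P → P 0 ⊎ Σ ℕ (P ∘ suc)
  from (zero , p)  = inj₁ p
  from (suc n , p) = inj₂ (n , p)
  to∘from : ∀ x → to (from x) ≡ x
  to∘from (zero , p)  = refl
  to∘from (suc n , p) = refl
  from∘to : ∀ x → from (to x) ≡ x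
  from∘to (inj₁ p) = refl
  from∘to (inj₂ p) = refl

finite-Σℕ : (P : ℕ → Set) (b : ℕ) → (∀ n → Finite (P n)) → (∀ n → P n → n ℕ.< b) →
            Finite (Σ ℕ P)
finite-Σℕ P zero    finite bounded =
  0 , mk↔ₛ′ (λ ()) (λ (n , p) → ⊥-elim (ℕ.n≮0 (bounded n p)))
            (λ (n , p) → ⊥-elim (ℕ.n≮0 (bounded n p))) (λ ())
finite-Σℕ P (suc b) finite bounded =
  finite-↔ (Σℕ↔⊎ P) (finite-⊎ (finite 0)
    (finite-Σℕ (P ∘ suc) b (finite ∘ suc) (λ n p → s<s⁻¹ (bounded (suc n) p))))

×-irrelevant : Irrelevant A → Irrelevant B → Irrelevant (A × B)
×-irrelevant irrA irrB (a , b) (a′ , b′) rewrite irrA a a′ | irrB b b′ = refl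

Σ-≡-irrelevant : {P : A → Set} → (∀ x → Irrelevant (P x)) →
                 {x y : A} {p : P x} {p′ : P y} → x ≡ y → (x , p) ≡ (y , p′)
Σ-≡-irrelevant irr refl = Σ-≡,≡→≡ (refl , irr _ _ _)

Σ-↔-irrelevant : {P : A → Set} {R : B → Set} →
                 (∀ x → Irrelevant (P x)) → (∀ y → Irrelevant (R y)) →
                 (to : Σ A P → Σ B R) (from : Σ B R → Σ A P) →
                 (∀ y → proj₁ (to (from y)) ≡ proj₁ y) →
                 (∀ x → proj₁ (from (to x)) ≡ proj₁ x) →
                 Σ A P ↔ Σ B R
Σ-↔-irrelevant irrP irrR to from to∘from from∘to =
  mk↔ₛ′ to from (λ y → Σ-≡-irrelevant irrR (to∘from y))
                (λ x → Σ-≡-irrelevant irrP (from∘to x))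

∣-irrelevant : ∀ {m n} .{{_ : ℕ.NonZero m}} → Irrelevant (m ℕ.∣ n)
∣-irrelevant {m} (ℕ.divides k n≡km) (ℕ.divides k′ n≡k′m)
  with ℕ.*-cancelʳ-≡ k k′ m (trans (sym n≡km) n≡k′m)
... | refl = cong (ℕ.divides k) (ℕ.≡-irrelevant n≡km n≡k′m)

m*n<o⇒m<o×n<o : ∀ {m n o} → 0 ℕ.< m → 0 ℕ.< n → m ℕ.* n ℕ.< o → m ℕ.< o × n ℕ.< o
m*n<o⇒m<o×n<o {m} {n} 0<m 0<n mn<o =
  ℕ.≤-<-trans (ℕ.m≤m*n m n {{>-nonZero 0<n}}) mn<o ,
  ℕ.≤-<-trans (ℕ.m≤n*m n m {{>-nonZero 0<m}}) mn<o

x-[x-y]≡y : ∀ x y → x - (x - y) ≡ y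
x-[x-y]≡y = solve-∀

≡[mod]⇔∃-multiple : ∀ x y q → x ≡ y [mod q ] ⇔ ∃ λ c → y ≡ x - c * q
≡[mod]⇔∃-multiple x y q = mk⇔ to from
  where
  to : x ≡ y [mod q ] → ∃ λ c → y ≡ x - c * q
  to x≡y with ℤ.∣ᵤ⇒∣ x≡y
  ... | ℤ.divides c x-y≡cq = c , trans (sym (x-[x-y]≡y x y)) (cong (_-_ x) x-y≡cq)
  from : (∃ λ c → y ≡ x - c * q) → x ≡ y [mod q ]
  from (c , refl) = ℤ.∣⇒∣ᵤ (ℤ.divides c (x-[x-y]≡y x (c * q)))

x-c*q-injective : ∀ x q {c c′} .{{_ : NonZero q}} →
                  x - c * q ≡ x - c′ * q → c ≡ c′
x-c*q-injective x q {c} {c′} eq = ℤ.*-cancelʳ-≡ c c′ q (begin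
  c * q             ≡⟨ sym (x-[x-y]≡y x (c * q)) ⟩
  x - (x - c * q)   ≡⟨ cong (_-_ x) eq ⟩
  x - (x - c′ * q)  ≡⟨ x-[x-y]≡y x (c′ * q) ⟩
  c′ * q            ∎)
  where open ≡-Reasoning

<⇔cross-multiplied : ∀ {p r : ℚ} {x y : ℚᵘ} → toℚᵘ p ℚᵘ.≃ x → toℚᵘ r ℚᵘ.≃ y →
                     p ℚ.< r ⇔ ↥ x * ↧ y < ↥ y * ↧ x
<⇔cross-multiplied p≃x r≃y = mk⇔
  (λ p<r → ℚᵘ.drop-*<* (ℚᵘ.<-respˡ-≃ p≃x (ℚᵘ.<-respʳ-≃ r≃y (ℚ.toℚᵘ-mono-< p<r))))
  (λ x<y → ℚ.toℚᵘ-cancel-< (ℚᵘ.<-respˡ-≃ (ℚᵘ.≃-sym p≃x) (ℚᵘ.<-respʳ-≃ (ℚᵘ.≃-sym r≃y) (*<* x<y))))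

<-resp-≡-⇔ : ∀ {i i′ j j′} → i ≡ i′ → j ≡ j′ → i < j ⇔ i′ < j′
<-resp-≡-⇔ refl refl = ⇔.refl

*-cancelʳ-<⇔ : ∀ {i j} n → i * + suc n < j * + suc n ⇔ i < j
*-cancelʳ-<⇔ n = mk⇔ (ℤ.*-cancelʳ-<-nonNeg (+ suc n)) (ℤ.*-monoʳ-<-pos (+ suc n))

toℚᵘ-frac-sub : ∀ a c Q D →
  toℚᵘ (frac a (+ suc Q) ℚ.- frac c (+ suc D)) ℚᵘ.≃ mkℚᵘ a Q ℚᵘ.- mkℚᵘ c D
toℚᵘ-frac-sub a c Q D = ℚᵘ.≃-trans (ℚ.toℚᵘ-homo-+ (frac a (+ suc Q)) (ℚ.- frac c (+ suc D)))
  (ℚᵘ.+-cong (ℚ.toℚᵘ-fromℚᵘ (mkℚᵘ a Q))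
             (ℚᵘ.≃-trans (ℚ.toℚᵘ-homo‿- (frac c (+ suc D))) (ℚᵘ.-‿cong (ℚ.toℚᵘ-fromℚᵘ (mkℚᵘ c D)))))

module _ (a c : ℤ) (Q D : ℕ) where
  private
    q d : ℤ
    q = + suc Q
    d = + suc D

  0<frac-sub⇔ : 0ℚ ℚ.< frac a q ℚ.- frac c d ⇔ 0ℤ < a * d - c * q
  0<frac-sub⇔ = ⇔.trans (<⇔cross-multiplied ℚᵘ.≃-refl (toℚᵘ-frac-sub a c Q D))
                        (<-resp-≡-⇔ refl (numerator a c d q))
    where
    numerator : ∀ a c d q → (a * d + (- c) * q) * + 1 ≡ a * d - c * q
    numerator = solve-∀

  frac-sub<1/d²⇔ : frac a q ℚ.- frac c d ℚ.< frac (+ 1) (d * d) ⇔ d * (a * d - c * q) < q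
  frac-sub<1/d²⇔ =
    ⇔.trans (<⇔cross-multiplied (toℚᵘ-frac-sub a c Q D)
                                (ℚ.toℚᵘ-fromℚᵘ (mkℚᵘ (+ 1) (ℕ.pred (suc D ℕ.* suc D)))))
            (⇔.trans (<-resp-≡-⇔ (lhs a c d q) (rhs (q * d))) (*-cancelʳ-<⇔ D))
    where
    lhs : ∀ a c d q → (a * d + (- c) * q) * (d * d) ≡ (d * (a * d - c * q)) * d
    lhs = solve-∀
    rhs : ∀ x → + 1 * x ≡ x
    rhs = solve-∀

InS : ℤ → ℤ → ℤ → ℤ → Set
InS a q m n = (0ℤ < m) × (0ℤ < n) × (m * n < q) × (a * m) ≡ n [mod q ]

InS-irrelevant : ∀ a Q m n → Irrelevant (InS a (+ suc Q) m n)
InS-irrelevant a Q m n =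
  ×-irrelevant ℤ.<-irrelevant (×-irrelevant ℤ.<-irrelevant (×-irrelevant ℤ.<-irrelevant ∣-irrelevant))

InS? : ∀ a q m n → Dec (InS a q m n)
InS? a q m n = (0ℤ ℤ.<? m) ×-dec (0ℤ ℤ.<? n) ×-dec (m * n ℤ.<? q) ×-dec (∣ q ∣ ℕ.∣? _)

InS⇒bounded : ∀ {a Q m n} → InS a (+ suc Q) (+ m) (+ n) → m ℕ.< suc Q × n ℕ.< suc Q
InS⇒bounded {m = m} {n} (0<m , 0<n , mn<q , _) =
  m*n<o⇒m<o×n<o (ℤ.drop‿+<+ 0<m) (ℤ.drop‿+<+ 0<n)
    (ℤ.drop‿+<+ (subst (_< _) (sym (ℤ.pos-* m n)) mn<q))

SSet↔Σℕ² : ∀ a q → SSet a q ↔ Σ ℕ λ m → Σ ℕ λ n → InS a q (+ m) (+ n)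
SSet↔Σℕ² a q = mk↔ₛ′ to from to∘from from∘to
  where
  to : SSet a q → Σ ℕ λ m → Σ ℕ λ n → InS a q (+ m) (+ n)
  to ((+ m , + n) , s)              = m , n , s
  to ((-[1+ _ ] , _) , () , _)
  to ((+ _ , -[1+ _ ]) , _ , () , _)
  from : (Σ ℕ λ m → Σ ℕ λ n → InS a q (+ m) (+ n)) → SSet a q
  from (m , n , s) = (+ m , + n) , s
  to∘from : ∀ x → to (from x) ≡ x
  to∘from (m , n , s) = refl
  from∘to : ∀ x → from (to x) ≡ x
  from∘to ((+ m , + n) , s)              = refl
  from∘to ((-[1+ _ ] , _) , () , _)
  from∘to ((+ _ , -[1+ _ ]) , _ , () , _)

finite-SSet : ∀ a Q → Finite (SSet a (+ suc Q))
finite-SSet a Q = finite-↔ (↔-sym (SSet↔Σℕ² a q))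
  (finite-Σℕ _ (suc Q)
    (λ m → finite-Σℕ _ (suc Q) (λ n → finite-Dec (InS? a q (+ m) (+ n)) (InS-irrelevant a Q (+ m) (+ n)))
                              (λ n s → proj₂ (InS⇒bounded {a} s)))
    (λ m (n , s) → proj₁ (InS⇒bounded {a} s)))
  where
  q = + suc Q

ApproxSet↔SSet : ∀ a Q → ApproxSet a (+ suc Q) ↔ SSet a (+ suc Q)
ApproxSet↔SSet a Q = Σ-↔-irrelevant
  (λ (c , d) → ×-irrelevant ℤ.<-irrelevant (×-irrelevant ℚ.<-irrelevant ℚ.<-irrelevant))
  (λ (m , n) → InS-irrelevant a Q m n)
  to from to∘from from∘to
  where
  q = + suc Q

  residue : ∀ d c → (a * d) ≡ a * d - c * q [mod q ]
  residue d c = Equivalence.from (≡[mod]⇔∃-multiple (a * d) _ q) (c , refl)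

  quotient : ∀ d {n} → (a * d) ≡ n [mod q ] → ∃ λ c → n ≡ a * d - c * q
  quotient d {n} = Equivalence.to (≡[mod]⇔∃-multiple (a * d) n q)

  to : ApproxSet a q → SSet a q
  to ((c , d@(+ suc D)) , 0<d , 0<δ , δ<1/d²) =
    (d , a * d - c * q) , 0<d , Equivalence.to (0<frac-sub⇔ a c Q D) 0<δ ,
    Equivalence.to (frac-sub<1/d²⇔ a c Q D) δ<1/d² , residue d c
  to ((_ , + zero) , +<+ () , _)
  to ((_ , -[1+ _ ]) , () , _)

  from : SSet a q → ApproxSet a q
  from ((m@(+ suc D) , n) , 0<m , 0<n , mn<q , am≡n) =
    (c , m) , 0<m , Equivalence.from (0<frac-sub⇔ a c Q D) (subst (0ℤ <_) n≡ 0<n) ,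
    Equivalence.from (frac-sub<1/d²⇔ a c Q D) (subst (λ t → m * t < q) n≡ mn<q)
    where
    c = proj₁ (quotient m am≡n)
    n≡ = proj₂ (quotient m am≡n)
  from ((+ zero , _) , +<+ () , _)
  from ((-[1+ _ ] , _) , () , _)

  to∘from : ∀ s → proj₁ (to (from s)) ≡ proj₁ s
  to∘from ((m@(+ suc _) , _) , _ , _ , _ , am≡n) = cong (m ,_) (sym (proj₂ (quotient m am≡n)))
  to∘from ((+ zero , _) , +<+ () , _)
  to∘from ((-[1+ _ ] , _) , () , _)

  from∘to : ∀ x → proj₁ (from (to x)) ≡ proj₁ x
  from∘to ((c , d@(+ suc _)) , _) =
    cong (_, d) (sym (x-c*q-injective (a * d) q (proj₂ (quotient d (residue d c)))))
  from∘to ((_ , + zero) , +<+ () , _)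
  from∘to ((_ , -[1+ _ ]) , () , _)

theorem3 : (a q : ℤ) → 0ℤ < q → gcd a q ≡ + 1 →
    Σ ℕ (λ k → (Fin k ↔ SSet a q) × (Fin k ↔ ApproxSet a q))
theorem3 a (+ suc Q) _ _ =
  let k , Fin↔S = finite-SSet a Q
  in  k , Fin↔S , ↔-trans Fin↔S (↔-sym (ApproxSet↔SSet a Q))
theorem3 a (+ zero)   (+<+ ()) _
theorem3 a -[1+ _ ]   ()       _
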